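{- Let $G=(V,E)$ be a $d$-dimensional square grid with $|V|=n=m^d$. Then \[ T_k=\begin{cases}\Theta(k^{1/(d+1)}) & k=O(n^{(d+1)/d}),\\ O(D)=O(d\,n^{1/d}) & k=\Omega(n^{(d+1)/d}).\end{cases} \]
   Context: A $d$-dimensional square grid graph with $n=m^d$ nodes is the Cartesian product $P_m\times\dots\times P_m$ of $d$ copies of the path $P_m$ on $m$ nodes. $D$ denotes the hop diameter of $G$, and $B_t(v)$ the set of nodes at hop distance at most $t$ from $v$. The broadcast quality is $T_k(v)=\min\big(\{t\in\mathbb{Z}_{\ge1} : |B_t(v)|\ge k/t\}\cup\{D\}\big)$ and $T_k=T_k(G)=\max_{v\in V}T_k(v)$. -}

module Defs where

open import Data.Nat using (ℕ; zero; suc; _+_; _*_; _∸_; _^_; _≤_)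
open import Data.Fin using (Fin; toℕ)
open import Data.Vec using (Vec; []; _∷_)
open import Data.List using (List; length)
open import Data.List.Relation.Unary.All using (All)
open import Data.List.Relation.Unary.Unique.Propositional using (Unique)
open import Data.Product using (Σ; _×_; ∃)
open import Data.Sum using (_⊎_)
open import Data.Empty using (⊥)
open import Relation.Binary.PropositionalEquality using (_≡_)

Node : ℕ → ℕ → Set
Node d m = Vec (Fin m) d

PathAdj : {m : ℕ} → Fin m → Fin m → Set
PathAdj i j = (suc (toℕ i) ≡ toℕ j) ⊎ (suc (toℕ j) ≡ toℕ i)

GridAdj : {d m : ℕ} → Node d m → Node d m → Set
GridAdj {zero}  []       []       = ⊥
GridAdj {suc d} (x ∷ xs) (y ∷ ys) = (x ≡ y × GridAdj xs ys) ⊎ (PathAdj x y × xs ≡ ys)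

-- Reach t v w : hop distance from v to w is at most t
-- (there is a walk of length ≤ t from v to w).
data Reach {d m : ℕ} : ℕ → Node d m → Node d m → Set where
  here : ∀ {t v} → Reach t v v
  step : ∀ {t v u w} → GridAdj v u → Reach t u w → Reach (suc t) v w

BallAtLeast : (d m : ℕ) → ℕ → Node d m → ℕ → Set
BallAtLeast d m t v x =
  Σ (List (Node d m)) λ ws → length ws ≡ x × Unique ws × All (Reach t v) ws

IsDiam : (d m : ℕ) → ℕ → Set
IsDiam d m D =
  (∀ (v w : Node d m) → Reach D v w) ×
  (∀ t → (∀ (v w : Node d m) → Reach t v w) → D ≤ t)

-- |B_t(v)| ≥ k / t  (real division), i.e. t · |B_t(v)| ≥ k.
Good : (d m k : ℕ) → Node d m → ℕ → Set
Good d m k v t = Σ ℕ λ x → k ≤ t * x × BallAtLeast d m t v x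

-- T is T_k(v) = min ({t ≥ 1 : |B_t(v)| ≥ k/t} ∪ {D}).
IsTkv : (d m k : ℕ) → Node d m → ℕ → Set
IsTkv d m k v T =
  Σ ℕ λ D → IsDiam d m D ×
    ((T ≡ D ⊎ (1 ≤ T × Good d m k v T)) ×
     T ≤ D ×
     (∀ t → 1 ≤ t → Good d m k v t → T ≤ t))

IsTk : (d m k : ℕ) → ℕ → Set
IsTk d m k T =
  (Σ (Node d m) λ v → IsTkv d m k v T) ×
  (∀ (v : Node d m) T' → IsTkv d m k v T' → T' ≤ T)

-- Hop distance on the grid is sandwiched between the Chebyshev distance d∞ of
-- the coordinates: d∞ ≤ dist ≤ d · d∞.  Hence the ball of radius t holds at
-- most (2t+1)^d nodes, and the ball of radius d·s holds at least (s+1)^d nodes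
-- as long as s < m.  If t is good, k ≤ t·|B_t| ≤ 3^d t^(d+1); if T = D,
-- then m ≤ 2D and k ≤ C m^(d+1) ≤ C 2^(d+1) T^(d+1).  Conversely, choosing s
-- with k ≤ s^(d+1) ≤ 2^(d+1) k, the radius d·s is good (or exceeds D),
-- so T ≤ d·s.
module Submission where

open import Defs
open import Data.Nat using (ℕ; zero; suc; _+_; _*_; _∸_; _^_; _≤_; _<_; _⊔_; ∣_-_∣; z≤n; s≤s)
open import Data.Nat.Properties
open import Data.Fin using (Fin; toℕ; fromℕ; fromℕ<) renaming (zero to fzero)
open import Data.Fin.Properties using (toℕ-injective; toℕ-fromℕ<; toℕ<n; toℕ-fromℕ)
open import Data.Vec as Vec using (Vec; []; _∷_; replicate)
open import Data.Vec.Properties using (∷-injective)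
open import Data.Vec.Relation.Binary.Pointwise.Inductive as Pointwise using (Pointwise; []; _∷_)
open import Data.List as List using (List; length; cartesianProductWith; tabulate; upTo)
open import Data.List.Properties using (length-++; length-map; length-tabulate; length-upTo; length-++-sucʳ)
open import Data.List.Membership.Propositional using (_∈_)
open import Data.List.Membership.Propositional.Properties
  using (∈-∃++; ∈-++⁻; ∈-++⁺ˡ; ∈-++⁺ʳ; ∈-cartesianProductWith⁺; ∈-cartesianProductWith⁻; ∈-map⁺; ∈-upTo⁺)
open import Data.List.Relation.Binary.Subset.Propositional using (_⊆_)
open import Data.List.Relation.Unary.All as All using (All)
open import Data.List.Relation.Unary.All.Properties as All using ()
open import Data.List.Relation.Unary.Any using (here; there)
open import Data.List.Relation.Unary.AllPairs using ([]; _∷_)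
open import Data.List.Relation.Unary.Unique.Propositional using (Unique)
open import Data.List.Relation.Unary.Unique.Propositional.Properties as Unique using ()
open import Data.Product using (Σ; _×_; _,_; ∃-syntax)
open import Data.Sum using (inj₁; inj₂; swap)
open import Relation.Nullary using (yes; no; contradiction)
open import Relation.Binary.PropositionalEquality
open import Algebra.Properties.CommutativeSemigroup *-commutativeSemigroup using (x∙yz≈y∙xz)

private
  variable
    A B : Set
    d m s t t′ : ℕ

^-distribʳ-* : ∀ a b n → (a * b) ^ n ≡ a ^ n * b ^ n
^-distribʳ-* a b zero    = refl
^-distribʳ-* a b (suc n) = begin
  a * b * (a * b) ^ n      ≡⟨ cong (a * b *_) (^-distribʳ-* a b n) ⟩
  a * b * (a ^ n * b ^ n)  ≡⟨ [m*n]*[o*p]≡[m*o]*[n*p] a b (a ^ n) (b ^ n) ⟩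
  a * a ^ n * (b * b ^ n)  ∎
  where open ≡-Reasoning

^-+1 : ∀ a n → a ^ (n + 1) ≡ a * a ^ n
^-+1 a n = cong (a ^_) (+-comm n 1)

∣n-1+n∣≡1 : ∀ n → ∣ n - suc n ∣ ≡ 1
∣n-1+n∣≡1 zero    = refl
∣n-1+n∣≡1 (suc n) = ∣n-1+n∣≡1 n

∣n-n∣≤t : ∀ n t → ∣ n - n ∣ ≤ t
∣n-n∣≤t n t = subst (_≤ t) (sym (∣n-n∣≡0 n)) z≤n

∣a+i-a+j∣≤s : ∀ a i j → i ≤ s → j ≤ s → ∣ a + i - a + j ∣ ≤ s
∣a+i-a+j∣≤s a i j i≤s j≤s = begin
  ∣ a + i - a + j ∣ ≡⟨ ∣m+n-m+o∣≡∣n-o∣ a i j ⟩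
  ∣ i - j ∣         ≤⟨ ∣m-n∣≤m⊔n i j ⟩
  i ⊔ j             ≤⟨ ⊔-lub i≤s j≤s ⟩
  _                 ∎
  where open ≤-Reasoning

-- Increase s only when k outgrows s^e; then (s+1)^e ≤ (2s)^e = 2^e k.
approximate-root : ∀ {e k} → 1 ≤ e → 1 ≤ k → ∃[ s ] 1 ≤ s × k ≤ s ^ e × s ^ e ≤ 2 ^ e * k
approximate-root {suc e} {suc k} _ _ = root e k
  where
  root : ∀ e k → ∃[ s ] 1 ≤ s × suc k ≤ s ^ suc e × s ^ suc e ≤ 2 ^ suc e * suc k
  root e zero = 1 , ≤-refl , ≤-reflexive (sym (^-zeroˡ (suc e))) ,
    ≤-trans (≤-reflexive (^-zeroˡ (suc e))) (≤-trans (m^n>0 2 (suc e)) (≤-reflexive (sym (*-identityʳ _))))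
  root e (suc k) with root e k
  ... | s , 1≤s , lower , upper with suc (suc k) ≤? s ^ suc e
  ...   | yes lower′ = s , 1≤s , lower′ , ≤-trans upper (*-monoʳ-≤ (2 ^ suc e) (n≤1+n _))
  ...   | no  ¬lower′ = suc s , s≤s z≤n , lower″ , upper″
    where
    sᵉ≡1+k : s ^ suc e ≡ suc k
    sᵉ≡1+k = ≤-antisym (≤-pred (≰⇒> ¬lower′)) lower
    lower″ : suc (suc k) ≤ suc s ^ suc e
    lower″ = subst (λ n → suc n ≤ suc s ^ suc e) sᵉ≡1+k (^-monoˡ-< (suc e) (n<1+n s))
    upper″ : suc s ^ suc e ≤ 2 ^ suc e * suc (suc k)
    upper″ = begin
      suc s ^ suc e         ≤⟨ ^-monoˡ-≤ (suc e) 1+s≤2*s ⟩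
      (2 * s) ^ suc e       ≡⟨ ^-distribʳ-* 2 s (suc e) ⟩
      2 ^ suc e * s ^ suc e ≡⟨ cong (2 ^ suc e *_) sᵉ≡1+k ⟩
      2 ^ suc e * suc k     ≤⟨ *-monoʳ-≤ (2 ^ suc e) (n≤1+n _) ⟩
      _                     ∎
      where
      open ≤-Reasoning
      1+s≤2*s : suc s ≤ 2 * s
      1+s≤2*s = ≤-trans (+-monoˡ-≤ s 1≤s) (≤-reflexive (cong (s +_) (sym (+-identityʳ s))))

Unique⇒⊆⇒length≤ : {xs ys : List A} → Unique xs → xs ⊆ ys → length xs ≤ length ys
Unique⇒⊆⇒length≤ [] _ = z≤n
Unique⇒⊆⇒length≤ {xs = x List.∷ xs} (x∉xs ∷ xs!) xs⊆ys with ∈-∃++ (xs⊆ys (here refl))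
... | ys₁ , ys₂ , refl =
  ≤-trans (s≤s (Unique⇒⊆⇒length≤ xs! xs⊆ys₁++ys₂)) (≤-reflexive (sym (length-++-sucʳ ys₁ x ys₂)))
  where
  xs⊆ys₁++ys₂ : xs ⊆ ys₁ List.++ ys₂
  xs⊆ys₁++ys₂ {y} y∈xs with ∈-++⁻ ys₁ (xs⊆ys (there y∈xs))
  ... | inj₁ y∈ys₁         = ∈-++⁺ˡ y∈ys₁
  ... | inj₂ (here refl)   = contradiction refl (All.lookup x∉xs y∈xs)
  ... | inj₂ (there y∈ys₂) = ∈-++⁺ʳ ys₁ y∈ys₂

length-cartesianProductWith : ∀ {C : Set} (f : A → B → C) xs ys →
  length (cartesianProductWith f xs ys) ≡ length xs * length ys
length-cartesianProductWith f List.[]         ys = refl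
length-cartesianProductWith f (x List.∷ xs) ys = begin
  length (List.map (f x) ys List.++ cartesianProductWith f xs ys) ≡⟨ length-++ (List.map (f x) ys) ⟩
  length (List.map (f x) ys) + length (cartesianProductWith f xs ys)
    ≡⟨ cong₂ _+_ (length-map (f x) ys) (length-cartesianProductWith f xs ys) ⟩
  length ys + length xs * length ys ∎
  where open ≡-Reasoning

box : (A → List B) → Vec A d → List (Vec B d)
box f []       = [] List.∷ List.[]
box f (x ∷ xs) = cartesianProductWith _∷_ (f x) (box f xs)

module _ (f : A → List B) where

  length-box : ∀ n → (∀ x → length (f x) ≡ n) → (v : Vec A d) → length (box f v) ≡ n ^ d
  length-box n ∣f∣≡n []      = refl
  length-box n ∣f∣≡n (x ∷ v) = trans (length-cartesianProductWith _∷_ (f x) (box f v))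
                                      (cong₂ _*_ (∣f∣≡n x) (length-box n ∣f∣≡n v))

  box-unique : (∀ x → Unique (f x)) → (v : Vec A d) → Unique (box f v)
  box-unique f! []      = All.[] ∷ []
  box-unique f! (x ∷ v) = Unique.cartesianProductWith⁺ _∷_ ∷-injective (f! x) (box-unique f! v)

  ∈-box⁺ : {v : Vec A d} {w : Vec B d} → Pointwise (λ x y → y ∈ f x) v w → w ∈ box f v
  ∈-box⁺ []          = here refl
  ∈-box⁺ (y∈ ∷ w∈s) = ∈-cartesianProductWith⁺ _∷_ y∈ (∈-box⁺ w∈s)

  ∈-box⁻ : (v : Vec A d) {w : Vec B d} → w ∈ box f v → Pointwise (λ x y → y ∈ f x) v w
  ∈-box⁻ []      {[]}    _ = []
  ∈-box⁻ (x ∷ v) {y ∷ w} w∈ with ∈-cartesianProductWith⁻ _∷_ (f x) (box f v) w∈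
  ... | _ , _ , y′∈ , w′∈ , eq with ∷-injective eq
  ...   | refl , refl = y′∈ ∷ ∈-box⁻ v w′∈

Reach-mono : {v w : Node d m} → t ≤ t′ → Reach t v w → Reach t′ v w
Reach-mono _         here       = here
Reach-mono (s≤s t≤t′) (step a r) = step a (Reach-mono t≤t′ r)

Reach-trans : {u v w : Node d m} → Reach s u v → Reach t v w → Reach (s + t) u w
Reach-trans {s = s} {t} here r = Reach-mono (m≤n+m t s) r
Reach-trans (step a r) r′ = step a (Reach-trans r r′)

GridAdj-sym : {v w : Node d m} → GridAdj v w → GridAdj w v
GridAdj-sym {v = []}    {[]}    ()
GridAdj-sym {v = _ ∷ _} {_ ∷ _} (inj₁ (refl , a)) = inj₁ (refl , GridAdj-sym a)
GridAdj-sym {v = _ ∷ _} {_ ∷ _} (inj₂ (a , refl)) = inj₂ (swap a , refl)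

Reach-sym : {v w : Node d m} → Reach t v w → Reach t w v
Reach-sym here = here
Reach-sym {t = suc t} {v} {w} (step a r) =
  subst (λ n → Reach n w v) (+-comm t 1) (Reach-trans (Reach-sym r) (step (GridAdj-sym a) here))

Reach-∷ : {x : Fin m} {xs ys : Node d m} → Reach t xs ys → Reach t (x ∷ xs) (x ∷ ys)
Reach-∷ here       = here
Reach-∷ (step a r) = step (inj₁ (refl , a)) (Reach-∷ r)

Reach-up : ∀ n (x y : Fin m) {xs : Node d m} → toℕ x + n ≡ toℕ y → Reach n (x ∷ xs) (y ∷ xs)
Reach-up zero x y eq with toℕ-injective (trans (sym (+-identityʳ (toℕ x))) eq)
... | refl = here
Reach-up {m = m} (suc n) x y eq =
  step (inj₂ (inj₁ (sym (toℕ-fromℕ< 1+x<m)) , refl))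
       (Reach-up n (fromℕ< 1+x<m) y (trans (cong (_+ n) (toℕ-fromℕ< 1+x<m)) (trans (sym (+-suc (toℕ x) n)) eq)))
  where
  1+x<m : suc (toℕ x) < m
  1+x<m = ≤-trans (s≤s (≤-trans (m≤m+n (suc (toℕ x)) n) (≤-reflexive (trans (sym (+-suc (toℕ x) n)) eq))))
                  (toℕ<n y)

Reach-head : (x y : Fin m) {xs : Node d m} → Reach ∣ toℕ x - toℕ y ∣ (x ∷ xs) (y ∷ xs)
Reach-head x y with ≤-total (toℕ x) (toℕ y)
... | inj₁ x≤y = Reach-mono (≤-reflexive (sym (m≤n⇒∣m-n∣≡n∸m x≤y)))
                            (Reach-up (toℕ y ∸ toℕ x) x y (m+[n∸m]≡n x≤y))
... | inj₂ y≤x = Reach-mono (≤-reflexive (sym (m≤n⇒∣n-m∣≡n∸m y≤x)))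
                            (Reach-sym (Reach-up (toℕ x ∸ toℕ y) y x (m+[n∸m]≡n y≤x)))

Within : ℕ → Node d m → Node d m → Set
Within t = Pointwise (λ x y → ∣ toℕ x - toℕ y ∣ ≤ t)

Within-refl : (v : Node d m) → Within t v v
Within-refl v = Pointwise.refl (λ {x} → ∣n-n∣≤t (toℕ x) _)

Within-trans : {u v w : Node d m} → Within s u v → Within t v w → Within (s + t) u w
Within-trans = Pointwise.trans (λ {x} {y} {z} p q → ≤-trans (∣-∣-triangle (toℕ x) (toℕ y) (toℕ z)) (+-mono-≤ p q))

GridAdj⇒Within1 : {v w : Node d m} → GridAdj v w → Within 1 v w
GridAdj⇒Within1 {v = []}     {[]}    ()
GridAdj⇒Within1 {v = x ∷ xs} {_ ∷ _} (inj₁ (refl , a)) =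
  ∣n-n∣≤t (toℕ x) 1 ∷ GridAdj⇒Within1 a
GridAdj⇒Within1 {v = x ∷ xs} {y ∷ _} (inj₂ (inj₁ 1+x≡y , refl)) =
  ≤-reflexive (trans (cong (∣ toℕ x -_∣) (sym 1+x≡y)) (∣n-1+n∣≡1 (toℕ x))) ∷ Within-refl xs
GridAdj⇒Within1 {v = x ∷ xs} {y ∷ _} (inj₂ (inj₂ 1+y≡x , refl)) =
  ≤-reflexive (trans (cong ∣_- toℕ y ∣ (sym 1+y≡x)) (trans (∣-∣-comm _ (toℕ y)) (∣n-1+n∣≡1 (toℕ y)))) ∷ Within-refl xs

Reach⇒Within : {v w : Node d m} → Reach t v w → Within t v w
Reach⇒Within {v = v} here = Within-refl v
Reach⇒Within (step a r)   = Within-trans (GridAdj⇒Within1 a) (Reach⇒Within r)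

Within⇒Reach : {v w : Node d m} → Within s v w → Reach (d * s) v w
Within⇒Reach []                        = here
Within⇒Reach {v = x ∷ _} {y ∷ _} (p ∷ ps) =
  Reach-trans (Reach-mono p (Reach-head x y)) (Reach-∷ (Within⇒Reach ps))

Within-all : (v w : Node d m) → Within m v w
Within-all []      []      = []
Within-all (x ∷ v) (y ∷ w) =
  ≤-trans (∣m-n∣≤m⊔n (toℕ x) (toℕ y)) (⊔-lub (<⇒≤ (toℕ<n x)) (<⇒≤ (toℕ<n y))) ∷ Within-all v w

IsDiam-unique : ∀ {D D′} → IsDiam d m D → IsDiam d m D′ → D ≤ D′
IsDiam-unique (_ , D-least) (D′-reaches , _) = D-least _ D′-reaches

IsDiam⇒D≤d*m : ∀ {D} → IsDiam d m D → D ≤ d * m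
IsDiam⇒D≤d*m (_ , D-least) = D-least _ (λ v w → Within⇒Reach (Within-all v w))

-- Opposite corners differ by m - 1 ≥ 1 in their first coordinate.
IsDiam⇒m≤2*D : ∀ {D} → 1 ≤ d → 1 < m → IsDiam d m D → m ≤ 2 * D
IsDiam⇒m≤2*D {suc d} {suc (suc m)} {D} _ (s≤s (s≤s z≤n)) (reaches , _)
  with m+1≤D ∷ _ ← Reach⇒Within (reaches (replicate (suc d) fzero) (replicate (suc d) (fromℕ (suc m)))) = begin
  1 + suc m ≤⟨ +-mono-≤ (≤-trans (s≤s z≤n) 1+m≤D) 1+m≤D ⟩
  D + D     ≡⟨ cong (D +_) (+-identityʳ D) ⟨
  2 * D     ∎
  where
  open ≤-Reasoning
  1+m≤D : suc m ≤ D
  1+m≤D = subst (_≤ D) (toℕ-fromℕ (suc m)) m+1≤D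

interval : ℕ → ℕ → List ℕ
interval t c = List.map ((c ∸ t) +_) (upTo (suc (t + t)))

length-interval : ∀ t c → length (interval t c) ≡ suc (t + t)
length-interval t c = trans (length-map ((c ∸ t) +_) (upTo (suc (t + t)))) (length-upTo (suc (t + t)))

∈-interval : ∀ t c x → ∣ c - x ∣ ≤ t → x ∈ interval t c
∈-interval t c x ∣c-x∣≤t =
  subst (_∈ interval t c) (m+[n∸m]≡n c∸t≤x) (∈-map⁺ ((c ∸ t) +_) (∈-upTo⁺ (s≤s x∸[c∸t]≤2t)))
  where
  open ≤-Reasoning
  c∸t≤x : c ∸ t ≤ x
  c∸t≤x = begin
    c ∸ t                 ≤⟨ ∸-monoˡ-≤ t (≤-trans (m≤n+∣m-n∣ c x) (+-monoʳ-≤ x ∣c-x∣≤t)) ⟩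
    x + t ∸ t             ≡⟨ m+n∸n≡m x t ⟩
    x                     ∎
  x∸[c∸t]≤2t : x ∸ (c ∸ t) ≤ t + t
  x∸[c∸t]≤2t = begin
    x ∸ (c ∸ t)             ≤⟨ ∸-monoˡ-≤ (c ∸ t) (≤-trans (m≤n+∣n-m∣ x c) (+-monoʳ-≤ c ∣c-x∣≤t)) ⟩
    c + t ∸ (c ∸ t)         ≤⟨ ∸-monoˡ-≤ (c ∸ t) (+-monoˡ-≤ t (m≤n+m∸n c t)) ⟩
    t + (c ∸ t) + t ∸ (c ∸ t) ≡⟨ cong (_∸ (c ∸ t)) (trans (cong (_+ t) (+-comm t (c ∸ t))) (+-assoc (c ∸ t) t t)) ⟩
    (c ∸ t) + (t + t) ∸ (c ∸ t) ≡⟨ m+n∸m≡n (c ∸ t) (t + t) ⟩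
    t + t                   ∎

toℕs : Node d m → Vec ℕ d
toℕs = Vec.map toℕ

toℕs-injective : {v w : Node d m} → toℕs v ≡ toℕs w → v ≡ w
toℕs-injective {v = []}    {[]}    _  = refl
toℕs-injective {v = x ∷ v} {y ∷ w} eq with ∷-injective eq
... | x≡y , v≡w = cong₂ _∷_ (toℕ-injective x≡y) (toℕs-injective v≡w)

-- The ball of radius t lies in the box of side 2t+1 around v.
BallAtLeast⇒x≤[2t+1]^d : ∀ {x} (v : Node d m) → BallAtLeast d m t v x → x ≤ suc (t + t) ^ d
BallAtLeast⇒x≤[2t+1]^d {d} {t = t} v (ws , refl , ws! , reach) = begin
  length ws                             ≡⟨ length-map toℕs ws ⟨
  length (List.map toℕs ws)             ≤⟨ Unique⇒⊆⇒length≤ (Unique.map⁺ toℕs-injective ws!) inBox ⟩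
  length (box (interval t) (toℕs v))    ≡⟨ length-box (interval t) (suc (t + t)) (length-interval t) (toℕs v) ⟩
  suc (t + t) ^ d                       ∎
  where
  open ≤-Reasoning
  inBox : List.map toℕs ws ⊆ box (interval t) (toℕs v)
  inBox p = All.lookup (All.map⁺ (All.map (λ r → ∈-box⁺ (interval t)
              (Pointwise.map⁺ (λ {x} {y} → ∈-interval t (toℕ x) (toℕ y)) (Reach⇒Within r))) reach)) p

record Window (s : ℕ) (x : Fin m) : Set where
  field
    elements : List (Fin m)
    length-elements : length elements ≡ suc s
    elements-unique : Unique elements
    elements-near : All (λ y → ∣ toℕ x - toℕ y ∣ ≤ s) elements

window : {x : Fin m} (a : ℕ) → a + s < m → a ≤ toℕ x → toℕ x ≤ a + s → Window s x
window {m} {s} {x} a a+s<m a≤x x≤a+s = record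
  { elements = tabulate elem
  ; length-elements = length-tabulate elem
  ; elements-unique = Unique.tabulate⁺ elem-injective
  ; elements-near = All.tabulate⁺ elem-near
  }
  where
  elem : Fin (suc s) → Fin m
  elem j = fromℕ< (≤-trans (s≤s (+-monoʳ-≤ a (≤-pred (toℕ<n j)))) a+s<m)
  toℕ-elem : ∀ j → toℕ (elem j) ≡ a + toℕ j
  toℕ-elem j = toℕ-fromℕ< _
  elem-injective : ∀ {i j} → elem i ≡ elem j → i ≡ j
  elem-injective {i} {j} eq = toℕ-injective (+-cancelˡ-≡ a _ _ (trans (sym (toℕ-elem i)) (trans (cong toℕ eq) (toℕ-elem j))))
  x∸a≤s : toℕ x ∸ a ≤ s
  x∸a≤s = ≤-trans (∸-monoˡ-≤ a x≤a+s) (≤-reflexive (m+n∸m≡n a s))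
  elem-near : ∀ j → ∣ toℕ x - toℕ (elem j) ∣ ≤ s
  elem-near j = subst₂ (λ u w → ∣ u - w ∣ ≤ s) (m+[n∸m]≡n a≤x) (sym (toℕ-elem j))
                       (∣a+i-a+j∣≤s a (toℕ x ∸ a) (toℕ j) x∸a≤s (≤-pred (toℕ<n j)))

-- Slide the window [x, x+s] left until it fits below m.
windowAround : s < m → (x : Fin m) → Window s x
windowAround {s} {m} s<m x with toℕ x + s <? m
... | yes x+s<m = window (toℕ x) x+s<m ≤-refl (m≤m+n (toℕ x) s)
... | no  x+s≮m = window (m ∸ suc s) a+s<m a≤x x≤a+s
  where
  open ≤-Reasoning
  a+1+s≡m : m ∸ suc s + suc s ≡ m
  a+1+s≡m = m∸n+n≡m s<m
  a+s<m : m ∸ suc s + s < m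
  a+s<m = ≤-reflexive (trans (sym (+-suc (m ∸ suc s) s)) a+1+s≡m)
  a≤x : m ∸ suc s ≤ toℕ x
  a≤x = begin
    m ∸ suc s     ≤⟨ ∸-monoʳ-≤ m (n≤1+n s) ⟩
    m ∸ s         ≤⟨ ∸-monoˡ-≤ s (≮⇒≥ x+s≮m) ⟩
    toℕ x + s ∸ s ≡⟨ m+n∸n≡m (toℕ x) s ⟩
    toℕ x         ∎
  x≤a+s : toℕ x ≤ m ∸ suc s + s
  x≤a+s = ≤-pred (≤-trans (toℕ<n x) (≤-reflexive (trans (sym a+1+s≡m) (+-suc (m ∸ suc s) s))))

BallAtLeast-[1+s]^d : s < m → (v : Node d m) → BallAtLeast d m (d * s) v (suc s ^ d)
BallAtLeast-[1+s]^d {s} s<m v =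
  box nearby v ,
  length-box nearby (suc s) (λ x → Window.length-elements (windowAround s<m x)) v ,
  box-unique nearby (λ x → Window.elements-unique (windowAround s<m x)) v ,
  All.tabulate (λ w∈ → Within⇒Reach (Pointwise.map (λ {x} → All.lookup (Window.elements-near (windowAround s<m x)))
                                                    (∈-box⁻ nearby v w∈)))
  where
  nearby : Fin _ → List (Fin _)
  nearby x = Window.elements (windowAround s<m x)

Good⇒k≤3^d*t^[d+1] : ∀ {k} {v : Node d m} → 1 ≤ t → Good d m k v t → k ≤ 3 ^ d * t ^ (d + 1)
Good⇒k≤3^d*t^[d+1] {d} {t = t} {k} {v} 1≤t (x , k≤t*x , ball) = begin
  k                       ≤⟨ k≤t*x ⟩
  t * x                   ≤⟨ *-monoʳ-≤ t (BallAtLeast⇒x≤[2t+1]^d v ball) ⟩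
  t * suc (t + t) ^ d     ≤⟨ *-monoʳ-≤ t (^-monoˡ-≤ d 1+2t≤3t) ⟩
  t * (3 * t) ^ d         ≡⟨ cong (t *_) (^-distribʳ-* 3 t d) ⟩
  t * (3 ^ d * t ^ d)     ≡⟨ x∙yz≈y∙xz t (3 ^ d) (t ^ d) ⟩
  3 ^ d * (t * t ^ d)     ≡⟨ cong (3 ^ d *_) (^-+1 t d) ⟨
  3 ^ d * t ^ (d + 1)     ∎
  where
  open ≤-Reasoning
  1+2t≤3t : suc (t + t) ≤ 3 * t
  1+2t≤3t = ≤-trans (+-monoˡ-≤ (t + t) 1≤t) (≤-reflexive (cong (λ u → t + (t + u)) (sym (+-identityʳ t))))

IsTkv⇒k≤[C*2^[d+1]+3^d]*T^[d+1] : ∀ {C k T} {v : Node d m} → 1 ≤ d → suc C ≤ k → k ≤ C * m ^ (d + 1) →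
  IsTkv d m k v T → k ≤ (C * 2 ^ (d + 1) + 3 ^ d) * T ^ (d + 1)
IsTkv⇒k≤[C*2^[d+1]+3^d]*T^[d+1] {d} {m} {C} {k} {T} 1≤d 1+C≤k k≤Cmᵉ (D , diam , T≡D⊎good , _)
  with T≡D⊎good
... | inj₂ (1≤T , good) = ≤-trans (Good⇒k≤3^d*t^[d+1] 1≤T good) (*-monoˡ-≤ (T ^ (d + 1)) (m≤n+m (3 ^ d) (C * 2 ^ (d + 1))))
... | inj₁ refl with m ≤? 1
...   | yes m≤1 = contradiction (≤-trans 1+C≤k (≤-trans k≤Cmᵉ Cmᵉ≤C)) (n≮n C)
  where
  Cmᵉ≤C : C * m ^ (d + 1) ≤ C
  Cmᵉ≤C = ≤-trans (*-monoʳ-≤ C (^-monoˡ-≤ (d + 1) m≤1))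
                  (≤-reflexive (trans (cong (C *_) (^-zeroˡ (d + 1))) (*-identityʳ C)))
...   | no  m≰1 = begin
  k                               ≤⟨ k≤Cmᵉ ⟩
  C * m ^ (d + 1)                 ≤⟨ *-monoʳ-≤ C (^-monoˡ-≤ (d + 1) (IsDiam⇒m≤2*D 1≤d (≰⇒> m≰1) diam)) ⟩
  C * (2 * T) ^ (d + 1)           ≡⟨ cong (C *_) (^-distribʳ-* 2 T (d + 1)) ⟩
  C * (2 ^ (d + 1) * T ^ (d + 1)) ≡⟨ *-assoc C _ _ ⟨
  C * 2 ^ (d + 1) * T ^ (d + 1)   ≤⟨ *-monoˡ-≤ (T ^ (d + 1)) (m≤m+n (C * 2 ^ (d + 1)) (3 ^ d)) ⟩
  (C * 2 ^ (d + 1) + 3 ^ d) * T ^ (d + 1) ∎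
  where open ≤-Reasoning

-- Either the radius d·s already exceeds the diameter, or the ball of that radius
-- is large enough to make d·s good.
IsTkv⇒T≤d*s : ∀ {k T} {v : Node d m} → 1 ≤ d → 1 ≤ s → k ≤ s ^ (d + 1) → IsTkv d m k v T → T ≤ d * s
IsTkv⇒T≤d*s {d} {m} {s} {k} {v = v} 1≤d@(s≤s z≤n) 1≤s k≤sᵉ (D , diam , _ , T≤D , T-least) with m ≤? s
... | yes m≤s = ≤-trans T≤D (≤-trans (IsDiam⇒D≤d*m diam) (*-monoʳ-≤ d m≤s))
... | no  m≰s = T-least (d * s) (*-mono-≤ 1≤d 1≤s) (suc s ^ d , k≤d*s*[1+s]^d , BallAtLeast-[1+s]^d (≰⇒> m≰s) v)
  where
  open ≤-Reasoning
  k≤d*s*[1+s]^d : k ≤ d * s * suc s ^ d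
  k≤d*s*[1+s]^d = begin
    k               ≤⟨ k≤sᵉ ⟩
    s ^ (d + 1)     ≡⟨ ^-+1 s d ⟩
    s * s ^ d       ≤⟨ *-mono-≤ (m≤n*m s d) (^-monoˡ-≤ d (n≤1+n s)) ⟩
    d * s * suc s ^ d ∎

IsTkv⇒T^[d+1]≤d^[d+1]*2^[d+1]*k : ∀ {k T} {v : Node d m} → 1 ≤ d → 1 ≤ k →
  IsTkv d m k v T → T ^ (d + 1) ≤ d ^ (d + 1) * 2 ^ (d + 1) * k
IsTkv⇒T^[d+1]≤d^[d+1]*2^[d+1]*k {d} {k = k} {T} 1≤d 1≤k Tkv
  with s , 1≤s , k≤sᵉ , sᵉ≤2ᵉk ← approximate-root (m≤n+m 1 d) 1≤k = begin
  T ^ (d + 1)                     ≤⟨ ^-monoˡ-≤ (d + 1) (IsTkv⇒T≤d*s 1≤d 1≤s k≤sᵉ Tkv) ⟩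
  (d * s) ^ (d + 1)               ≡⟨ ^-distribʳ-* d s (d + 1) ⟩
  d ^ (d + 1) * s ^ (d + 1)       ≤⟨ *-monoʳ-≤ (d ^ (d + 1)) sᵉ≤2ᵉk ⟩
  d ^ (d + 1) * (2 ^ (d + 1) * k) ≡⟨ *-assoc (d ^ (d + 1)) _ _ ⟨
  d ^ (d + 1) * 2 ^ (d + 1) * k   ∎
  where open ≤-Reasoning

mainTheorem4 : ∀ (d : ℕ) → 1 ≤ d →
    (∀ (C : ℕ) → Σ ℕ λ c → Σ ℕ λ k₀ →
      ∀ (m k T : ℕ) → 1 ≤ m → k₀ ≤ k → k ≤ C * m ^ (d + 1) → IsTk d m k T →
      k ≤ c * T ^ (d + 1) × T ^ (d + 1) ≤ c * k)
  × (∀ (c : ℕ) → 1 ≤ c → Σ ℕ λ C →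
      ∀ (m k T D : ℕ) → 1 ≤ m → m ^ (d + 1) ≤ c * k → IsTk d m k T → IsDiam d m D →
      T ≤ C * D × D ≤ C * (d * m))
mainTheorem4 d 1≤d =
  (λ C → c₁ C + c₂ , suc C , λ m k T _ 1+C≤k k≤Cmᵉ ((_ , Tkv) , _) →
    ≤-trans (IsTkv⇒k≤[C*2^[d+1]+3^d]*T^[d+1] 1≤d 1+C≤k k≤Cmᵉ Tkv) (*-monoˡ-≤ (T ^ (d + 1)) (m≤m+n (c₁ C) c₂)) ,
    ≤-trans (IsTkv⇒T^[d+1]≤d^[d+1]*2^[d+1]*k 1≤d (≤-trans (s≤s z≤n) 1+C≤k) Tkv) (*-monoˡ-≤ k (m≤n+m c₂ (c₁ C)))) ,
  (λ _ _ → 1 , λ m k T D _ _ ((_ , D′ , diam′ , _ , T≤D′ , _) , _) diam →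
    ≤-trans T≤D′ (≤-trans (IsDiam-unique diam′ diam) (≤-reflexive (sym (*-identityˡ D)))) ,
    ≤-trans (IsDiam⇒D≤d*m diam) (≤-reflexive (sym (*-identityˡ (d * m)))))
  where
  c₁ : ℕ → ℕ
  c₁ C = C * 2 ^ (d + 1) + 3 ^ d
  c₂ : ℕ
  c₂ = d ^ (d + 1) * 2 ^ (d + 1)
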